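{- Let $G=(V,E)$ be an undirected connected multi-graph with Steiner set $S\subseteq V$ and $S$-mincut capacity $\lambda_S$. There is no Steiner cut of capacity $\lambda_S+1$ that subdivides more than one $(\lambda_S+1)$-connectivity class of $G$.
   Context: Cuts are nonempty proper subsets $C\subset V$; capacity is the number of edges (with multiplicity) with exactly one endpoint in $C$; $C$ subdivides $X$ if both $C\cap X$ and $X\setminus C$ are nonempty. A Steiner cut contains some but not all vertices of $S$; an $S$-mincut is a Steiner cut of minimum capacity $\lambda_S$. The $(\lambda_S+1)$-connectivity classes are the equivalence classes of the relation "no $S$-mincut contains exactly one of $u,v$". -}

module Defs where

open import Data.Nat using (ℕ; zero; suc; _+_; _≤_)
open import Data.Bool using (Bool; true; false; _xor_)
open import Data.Fin using (Fin)
open import Data.Fin.Subset using (Subset; _∈_; _∉_)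
open import Data.Vec using (lookup)
open import Data.List using (List; []; _∷_)
open import Data.Product using (_×_; _,_; ∃; ∃-syntax)
open import Relation.Nullary using (¬_)
open import Relation.Binary.PropositionalEquality using (_≡_)
open import Function.Bundles using (_⇔_)
import Data.List.Membership.Propositional as LM

-- An undirected multigraph on vertex set Fin n: a list of edges; an entry
-- (u , v) is an edge joining u and v; multiplicity is given by repetition.
MultiGraph : ℕ → Set
MultiGraph n = List (Fin n × Fin n)

data Reach {n : ℕ} (E : MultiGraph n) : Fin n → Fin n → Set where
  here  : ∀ {u} → Reach E u u
  stepˡ : ∀ {u v w} → (u , v) LM.∈ E → Reach E v w → Reach E u w
  stepʳ : ∀ {u v w} → (v , u) LM.∈ E → Reach E v w → Reach E u w

Connected : ∀ {n} → MultiGraph n → Set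
Connected {n} E = (u v : Fin n) → Reach E u v

capacity : ∀ {n} → MultiGraph n → Subset n → ℕ
capacity [] C = 0
capacity ((u , v) ∷ E) C with lookup C u xor lookup C v
... | true  = suc (capacity E C)
... | false = capacity E C

IsCut : ∀ {n} → Subset n → Set
IsCut {n} C = (∃[ x ] x ∈ C) × (∃[ y ] y ∉ C)

SteinerCut : ∀ {n} → Subset n → Subset n → Set
SteinerCut {n} S C = IsCut C × (∃[ s ] (s ∈ S × s ∈ C)) × (∃[ t ] (t ∈ S × t ∉ C))

IsSMincutCapacity : ∀ {n} → MultiGraph n → Subset n → ℕ → Set
IsSMincutCapacity {n} E S λS =
  (∃[ C ] (SteinerCut S C × capacity E C ≡ λS)) ×
  ((C : Subset n) → SteinerCut S C → λS ≤ capacity E C)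

SMincut : ∀ {n} → MultiGraph n → Subset n → ℕ → Subset n → Set
SMincut E S λS C = SteinerCut S C × capacity E C ≡ λS

-- The relation defining the (λ_S+1)-connectivity classes: no S-mincut
-- contains exactly one of u, v.
SameClass : ∀ {n} → MultiGraph n → Subset n → ℕ → Fin n → Fin n → Set
SameClass {n} E S λS u v = (C : Subset n) → SMincut E S λS C → (u ∈ C ⇔ v ∈ C)

SubdividesClassOf : ∀ {n} → MultiGraph n → Subset n → ℕ → Subset n → Fin n → Set
SubdividesClassOf E S λS C a =
  (∃[ x ] (SameClass E S λS a x × x ∈ C)) × (∃[ y ] (SameClass E S λS a y × y ∉ C))

{-# OPTIONS --safe #-}
module Submission where

-- Uncrossing.  Suppose C has capacity λS + 1, subdivides the classes of a and b,
-- and an S-mincut M separates a from b.  Capacity is submodular and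
-- posimodular, so cap (C ∩ M) + cap (C ∪ M) and cap (C ∖ M) + cap (M ∖ C) are
-- both at most 2 λS + 1; for one of the two pairs both sets are Steiner cuts,
-- hence one of them is an S-mincut.  But each of these four sets contains one
-- vertex and misses another of the class of a or of the class of b, which no
-- S-mincut can do.

open import Defs
open import Algebra.Lattice.Properties.BooleanAlgebra using (deMorgan₁; ¬-involutive)
open import Algebra.Properties.CommutativeSemigroup using (interchange)
open import Data.Bool using (Bool; true; false; not; _∧_; _∨_; _xor_)
open import Data.Bool.Properties using (not-involutive)
open import Data.Empty using (⊥)
open import Data.Fin using (Fin)
open import Data.Fin.Subset using (Subset; _∈_; _∉_; _∩_; _∪_; ∁)
open import Data.Fin.Subset.Properties
  using (_∈?_; x∈p∩q⁺; x∈p∩q⁻; x∈p∪q⁺; x∈p∪q⁻; x∉p⇒x∈∁p; x∈∁p⇒x∉p; ∪-comm; ∪-∩-booleanAlgebra)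
open import Data.List using ([]; _∷_)
open import Data.Nat using (ℕ; suc; _+_; _≤_; z≤n)
open import Data.Nat.Properties
  using (≤ᵇ⇒≤; _≤?_; ≰⇒>; ≤-antisym; ≤-trans; ≤-reflexive; +-mono-≤; +-monoˡ-≤; +-cancelˡ-≤;
         +-commutativeSemigroup; module ≤-Reasoning)
open import Data.Product using (_×_; _,_; proj₁; proj₂; ∃-syntax)
open import Data.Sum using (_⊎_; inj₁; inj₂; [_,_]; map)
open import Data.Vec using (lookup)
open import Data.Vec.Properties using (lookup-zipWith; lookup-map)
open import Function.Base using (_∘_)
open import Function.Bundles using (Equivalence; mk⇔)
open import Relation.Binary.PropositionalEquality using (_≡_; refl; sym; trans; cong; cong₂)
open import Relation.Nullary using (¬_; yes; no)
open import Relation.Nullary.Decidable using (decidable-stable)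

m+n≤1+k+k⇒m≡k⊎n≡k : ∀ {m n k} → m + n ≤ suc k + k → k ≤ m → k ≤ n → m ≡ k ⊎ n ≡ k
m+n≤1+k+k⇒m≡k⊎n≡k {m} {n} {k} m+n≤1+k+k k≤m k≤n with m ≤? k
... | yes m≤k = inj₁ (≤-antisym m≤k k≤m)
... | no  m≰k = inj₂ (≤-antisym n≤k k≤n)
  where
  n≤k : n ≤ k
  n≤k = +-cancelˡ-≤ (suc k) n k (≤-trans (+-monoˡ-≤ n (≰⇒> m≰k)) m+n≤1+k+k)

module _ {n : ℕ} {x : Fin n} {p q : Subset n} where

  x∉p⇒x∉p∩q : x ∉ p → x ∉ p ∩ q
  x∉p⇒x∉p∩q x∉p x∈p∩q = x∉p (proj₁ (x∈p∩q⁻ p q x∈p∩q))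

  x∉p∧x∉q⇒x∉p∪q : x ∉ p → x ∉ q → x ∉ p ∪ q
  x∉p∧x∉q⇒x∉p∪q x∉p x∉q x∈p∪q = [ x∉p , x∉q ] (x∈p∪q⁻ p q x∈p∪q)

  x∈p∧x∉q⇒x∈p∩∁q : x ∈ p → x ∉ q → x ∈ p ∩ ∁ q
  x∈p∧x∉q⇒x∈p∩∁q x∈p x∉q = x∈p∩q⁺ (x∈p , x∉p⇒x∈∁p x∉q)

  x∈q⇒x∉p∩∁q : x ∈ q → x ∉ p ∩ ∁ q
  x∈q⇒x∉p∩∁q x∈q x∈p∩∁q = x∈∁p⇒x∉p (proj₂ (x∈p∩q⁻ p (∁ q) x∈p∩∁q)) x∈q

indicator : Bool → ℕ
indicator true  = 1
indicator false = 0

crossing : ∀ {n} → Subset n → Fin n → Fin n → ℕ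
crossing X u v = indicator (lookup X u xor lookup X v)

capacity-∷ : ∀ {n} (u v : Fin n) (E : MultiGraph n) (X : Subset n) →
  capacity ((u , v) ∷ E) X ≡ crossing X u v + capacity E X
capacity-∷ u v E X with lookup X u xor lookup X v
... | true  = refl
... | false = refl

capacity-+-≤ : ∀ {n} {A B C D : Subset n} →
  (∀ u v → crossing A u v + crossing B u v ≤ crossing C u v + crossing D u v) →
  (E : MultiGraph n) → capacity E A + capacity E B ≤ capacity E C + capacity E D
capacity-+-≤ edgewise [] = z≤n
capacity-+-≤ {A = A} {B} {C} {D} edgewise ((u , v) ∷ E) = begin
  capacity ((u , v) ∷ E) A + capacity ((u , v) ∷ E) B
    ≡⟨ cong₂ _+_ (capacity-∷ u v E A) (capacity-∷ u v E B) ⟩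
  (crossing A u v + capacity E A) + (crossing B u v + capacity E B)
    ≡⟨ interchange +-commutativeSemigroup (crossing A u v) (capacity E A) (crossing B u v) (capacity E B) ⟩
  (crossing A u v + crossing B u v) + (capacity E A + capacity E B)
    ≤⟨ +-mono-≤ (edgewise u v) (capacity-+-≤ edgewise E) ⟩
  (crossing C u v + crossing D u v) + (capacity E C + capacity E D)
    ≡⟨ interchange +-commutativeSemigroup (crossing C u v) (crossing D u v) (capacity E C) (capacity E D) ⟩
  (crossing C u v + capacity E C) + (crossing D u v + capacity E D)
    ≡⟨ sym (cong₂ _+_ (capacity-∷ u v E C) (capacity-∷ u v E D)) ⟩
  capacity ((u , v) ∷ E) C + capacity ((u , v) ∷ E) D ∎
  where open ≤-Reasoning

not-xor-not : ∀ a b → not a xor not b ≡ a xor b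
not-xor-not true  b = refl
not-xor-not false b = not-involutive b

capacity-∁ : ∀ {n} (E : MultiGraph n) (X : Subset n) → capacity E (∁ X) ≡ capacity E X
capacity-∁ [] X = refl
capacity-∁ ((u , v) ∷ E) X
  rewrite capacity-∷ u v E (∁ X) | capacity-∷ u v E X
        | lookup-map u not X | lookup-map v not X | not-xor-not (lookup X u) (lookup X v)
  = cong (crossing X u v +_) (capacity-∁ E X)

indicator-xor-submodular : ∀ c c′ m m′ →
  indicator ((c ∧ m) xor (c′ ∧ m′)) + indicator ((c ∨ m) xor (c′ ∨ m′))
    ≤ indicator (c xor c′) + indicator (m xor m′)
indicator-xor-submodular true  true  true  true  = ≤ᵇ⇒≤ _ _ _
indicator-xor-submodular true  true  true  false = ≤ᵇ⇒≤ _ _ _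
indicator-xor-submodular true  true  false true  = ≤ᵇ⇒≤ _ _ _
indicator-xor-submodular true  true  false false = ≤ᵇ⇒≤ _ _ _
indicator-xor-submodular true  false true  true  = ≤ᵇ⇒≤ _ _ _
indicator-xor-submodular true  false true  false = ≤ᵇ⇒≤ _ _ _
indicator-xor-submodular true  false false true  = ≤ᵇ⇒≤ _ _ _
indicator-xor-submodular true  false false false = ≤ᵇ⇒≤ _ _ _
indicator-xor-submodular false true  true  true  = ≤ᵇ⇒≤ _ _ _
indicator-xor-submodular false true  true  false = ≤ᵇ⇒≤ _ _ _
indicator-xor-submodular false true  false true  = ≤ᵇ⇒≤ _ _ _
indicator-xor-submodular false true  false false = ≤ᵇ⇒≤ _ _ _
indicator-xor-submodular false false true  true  = ≤ᵇ⇒≤ _ _ _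
indicator-xor-submodular false false true  false = ≤ᵇ⇒≤ _ _ _
indicator-xor-submodular false false false true  = ≤ᵇ⇒≤ _ _ _
indicator-xor-submodular false false false false = ≤ᵇ⇒≤ _ _ _

capacity-submodular : ∀ {n} (E : MultiGraph n) (C M : Subset n) →
  capacity E (C ∩ M) + capacity E (C ∪ M) ≤ capacity E C + capacity E M
capacity-submodular E C M = capacity-+-≤ crossing-∩∪ E
  where
  crossing-∩∪ : ∀ u v → crossing (C ∩ M) u v + crossing (C ∪ M) u v ≤ crossing C u v + crossing M u v
  crossing-∩∪ u v
    rewrite lookup-zipWith _∧_ u C M | lookup-zipWith _∧_ v C M
          | lookup-zipWith _∨_ u C M | lookup-zipWith _∨_ v C M
    = indicator-xor-submodular (lookup C u) (lookup C v) (lookup M u) (lookup M v)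

capacity-posimodular : ∀ {n} (E : MultiGraph n) (C M : Subset n) →
  capacity E (C ∩ ∁ M) + capacity E (M ∩ ∁ C) ≤ capacity E C + capacity E M
capacity-posimodular {n} E C M = begin
  capacity E (C ∩ ∁ M) + capacity E (M ∩ ∁ C)
    ≡⟨ cong (capacity E (C ∩ ∁ M) +_) (sym (capacity-∁ E (M ∩ ∁ C))) ⟩
  capacity E (C ∩ ∁ M) + capacity E (∁ (M ∩ ∁ C))
    ≡⟨ cong (λ X → capacity E (C ∩ ∁ M) + capacity E X) ∁[M∩∁C]≡C∪∁M ⟩
  capacity E (C ∩ ∁ M) + capacity E (C ∪ ∁ M)
    ≤⟨ capacity-submodular E C (∁ M) ⟩
  capacity E C + capacity E (∁ M)
    ≡⟨ cong (capacity E C +_) (capacity-∁ E M) ⟩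
  capacity E C + capacity E M ∎
  where
  open ≤-Reasoning
  ∁[M∩∁C]≡C∪∁M : ∁ (M ∩ ∁ C) ≡ C ∪ ∁ M
  ∁[M∩∁C]≡C∪∁M = trans (deMorgan₁ (∪-∩-booleanAlgebra n) M (∁ C))
    (trans (cong (∁ M ∪_) (¬-involutive (∪-∩-booleanAlgebra n) C)) (∪-comm (∁ M) C))

module _ {n : ℕ} {S : Subset n} where

  steinerCut : ∀ {A s t} → s ∈ S → s ∈ A → t ∈ S → t ∉ A → SteinerCut S A
  steinerCut {s = s} {t} s∈S s∈A t∈S t∉A = ((s , s∈A) , (t , t∉A)) , (s , s∈S , s∈A) , (t , t∈S , t∉A)

  ∩-∪-steinerCuts : ∀ {C M p q} → p ∈ S → p ∈ C → p ∈ M → q ∈ S → q ∉ C → q ∉ M →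
    SteinerCut S (C ∩ M) × SteinerCut S (C ∪ M)
  ∩-∪-steinerCuts p∈S p∈C p∈M q∈S q∉C q∉M =
    steinerCut p∈S (x∈p∩q⁺ (p∈C , p∈M)) q∈S (x∉p⇒x∉p∩q q∉C) ,
    steinerCut p∈S (x∈p∪q⁺ (inj₁ p∈C)) q∈S (x∉p∧x∉q⇒x∉p∪q q∉C q∉M)

  differences-steinerCuts : ∀ {C M p q} → p ∈ S → p ∈ C → p ∉ M → q ∈ S → q ∉ C → q ∈ M →
    SteinerCut S (C ∩ ∁ M) × SteinerCut S (M ∩ ∁ C)
  differences-steinerCuts p∈S p∈C p∉M q∈S q∉C q∈M =
    steinerCut p∈S (x∈p∧x∉q⇒x∈p∩∁q p∈C p∉M) q∈S (x∈q⇒x∉p∩∁q q∈M) ,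
    steinerCut q∈S (x∈p∧x∉q⇒x∈p∩∁q q∈M q∉C) p∈S (x∈q⇒x∉p∩∁q p∈C)

  steinerCut-uncrossing : ∀ {C M} → SteinerCut S C → SteinerCut S M →
    (SteinerCut S (C ∩ M) × SteinerCut S (C ∪ M)) ⊎ (SteinerCut S (C ∩ ∁ M) × SteinerCut S (M ∩ ∁ C))
  steinerCut-uncrossing {C} {M}
    (_ , (s , s∈S , s∈C) , (t , t∈S , t∉C)) (_ , (s′ , s′∈S , s′∈M) , (t′ , t′∈S , t′∉M))
    with s ∈? M | t ∈? M | s′ ∈? C | t′ ∈? C
  ... | yes s∈M | no  t∉M | _        | _        = inj₁ (∩-∪-steinerCuts s∈S s∈C s∈M t∈S t∉C t∉M)
  ... | no  s∉M | yes t∈M | _        | _        = inj₂ (differences-steinerCuts s∈S s∈C s∉M t∈S t∉C t∈M)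
  ... | yes s∈M | yes t∈M | _        | yes t′∈C = inj₂ (differences-steinerCuts t′∈S t′∈C t′∉M t∈S t∉C t∈M)
  ... | yes s∈M | yes t∈M | _        | no  t′∉C = inj₁ (∩-∪-steinerCuts s∈S s∈C s∈M t′∈S t′∉C t′∉M)
  ... | no  s∉M | no  t∉M | yes s′∈C | _        = inj₁ (∩-∪-steinerCuts s′∈S s′∈C s′∈M t∈S t∉C t∉M)
  ... | no  s∉M | no  t∉M | no  s′∉C | _        = inj₂ (differences-steinerCuts s∈S s∈C s∉M s′∈S s′∉C s′∈M)

sameClass-sameSide : ∀ {n} {E : MultiGraph n} {S : Subset n} {λS : ℕ} {a x y : Fin n} {M : Subset n} →
  SameClass E S λS a x → SameClass E S λS a y → SMincut E S λS M → x ∈ M → y ∈ M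
sameClass-sameSide {M = M} a~x a~y mM x∈M = Equivalence.to (a~y M mM) (Equivalence.from (a~x M mM) x∈M)

module _ {n : ℕ} (E : MultiGraph n) {S : Subset n} {λS : ℕ} (isMin : IsSMincutCapacity E S λS) where

  one-of-pair-is-SMincut : ∀ {A B} → SteinerCut S A → SteinerCut S B →
    capacity E A + capacity E B ≤ suc λS + λS → SMincut E S λS A ⊎ SMincut E S λS B
  one-of-pair-is-SMincut stA stB bound =
    map (stA ,_) (stB ,_) (m+n≤1+k+k⇒m≡k⊎n≡k bound (proj₂ isMin _ stA) (proj₂ isMin _ stB))

  no-mincut-separates-subdivided-classes : ∀ {C M a b} → SteinerCut S C → capacity E C ≤ suc λS →
    SubdividesClassOf E S λS C a → SubdividesClassOf E S λS C b →
    SMincut E S λS M → a ∈ M → b ∉ M → ⊥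
  no-mincut-separates-subdivided-classes {C} {M} stC capC
    ((x₁ , a~x₁ , x₁∈C) , (y₁ , a~y₁ , y₁∉C)) ((x₂ , b~x₂ , x₂∈C) , (y₂ , b~y₂ , y₂∉C)) mM a∈M b∉M =
    [ uncross-∩-∪ , uncross-differences ] (steinerCut-uncrossing stC (proj₁ mM))
    where
    x₁∈M : x₁ ∈ M
    x₁∈M = Equivalence.to (a~x₁ M mM) a∈M
    y₁∈M : y₁ ∈ M
    y₁∈M = Equivalence.to (a~y₁ M mM) a∈M
    x₂∉M : x₂ ∉ M
    x₂∉M = b∉M ∘ Equivalence.from (b~x₂ M mM)
    y₂∉M : y₂ ∉ M
    y₂∉M = b∉M ∘ Equivalence.from (b~y₂ M mM)

    below-1+2λS : ∀ {k} → k ≤ capacity E C + capacity E M → k ≤ suc λS + λS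
    below-1+2λS k≤ = ≤-trans k≤ (+-mono-≤ capC (≤-reflexive (proj₂ mM)))

    splits-class⇒¬SMincut : ∀ {c x y A} → SameClass E S λS c x → SameClass E S λS c y → x ∈ A → y ∉ A →
      ¬ SMincut E S λS A
    splits-class⇒¬SMincut c~x c~y x∈A y∉A mA = y∉A (sameClass-sameSide {E = E} c~x c~y mA x∈A)

    uncross-∩-∪ : SteinerCut S (C ∩ M) × SteinerCut S (C ∪ M) → ⊥
    uncross-∩-∪ (st∩ , st∪) =
      [ splits-class⇒¬SMincut a~x₁ a~y₁ (x∈p∩q⁺ (x₁∈C , x₁∈M)) (x∉p⇒x∉p∩q y₁∉C)
      , splits-class⇒¬SMincut b~x₂ b~y₂ (x∈p∪q⁺ (inj₁ x₂∈C)) (x∉p∧x∉q⇒x∉p∪q y₂∉C y₂∉M)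
      ] (one-of-pair-is-SMincut st∩ st∪ (below-1+2λS (capacity-submodular E C M)))

    uncross-differences : SteinerCut S (C ∩ ∁ M) × SteinerCut S (M ∩ ∁ C) → ⊥
    uncross-differences (st₁ , st₂) =
      [ splits-class⇒¬SMincut b~x₂ b~y₂ (x∈p∧x∉q⇒x∈p∩∁q x₂∈C x₂∉M) (x∉p⇒x∉p∩q y₂∉C)
      , splits-class⇒¬SMincut a~y₁ a~x₁ (x∈p∧x∉q⇒x∈p∩∁q y₁∈M y₁∉C) (x∈q⇒x∉p∩∁q x₁∈C)
      ] (one-of-pair-is-SMincut st₁ st₂ (below-1+2λS (capacity-posimodular E C M)))

  subdivided-classes-coincide : ∀ {C a b} → SteinerCut S C → capacity E C ≤ suc λS →
    SubdividesClassOf E S λS C a → SubdividesClassOf E S λS C b → SameClass E S λS a b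
  subdivided-classes-coincide {C} stC capC subA subB M mM = mk⇔ (sameSide subA subB) (sameSide subB subA)
    where
    sameSide : ∀ {a b} → SubdividesClassOf E S λS C a → SubdividesClassOf E S λS C b → a ∈ M → b ∈ M
    sameSide {b = b} subA subB a∈M =
      decidable-stable (b ∈? M) (no-mincut-separates-subdivided-classes stC capC subA subB mM a∈M)

lemma61 : (n : ℕ) (E : MultiGraph n) (S : Subset n) (λS : ℕ) →
    Connected E → IsSMincutCapacity E S λS →
    ¬ (∃[ C ] (SteinerCut S C × capacity E C ≡ suc λS ×
         ∃[ a ] ∃[ b ] (¬ SameClass E S λS a b ×
           SubdividesClassOf E S λS C a × SubdividesClassOf E S λS C b)))
lemma61 n E S λS _ isMin (C , stC , capC , a , b , a≁b , subA , subB) =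
  a≁b (subdivided-classes-coincide E isMin stC (≤-reflexive capC) subA subB)
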